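{- Let $G$ be the graph constructed (as described in the context) from an instance $\langle \overline{X},\overline{C}\rangle$ of Exact 3-Cover with $|\overline{X}|=3q$, $q$ even, and let $f$ be a minimum-weight Roman $\{3\}$-dominating function on $G$. Then $f(A)\ge 3q$ and $f(B)\ge 3q$, where $f(S)=\sum_{u\in S}f(u)$.
   Context: A Roman $\{3\}$-dominating function on a graph $G=(V,E)$ is a function $f:V\to\{0,1,2,3\}$ such that for every $u\in V$: if $f(u)=0$ then $\sum_{v\in N(u)} f(v)\ge 3$, and if $f(u)=1$ then $\sum_{v\in N(u)} f(v)\ge 2$ ($N(u)$ the open neighbourhood); its weight is $\sum_{u\in V}f(u)$. An instance of Exact 3-Cover consists of a set $\overline{X}=\{\overline{x}_1,\dots,\overline{x}_{3q}\}$ and a collection $\overline{C}=\{\overline{C}_1,\dots,\overline{C}_t\}$ of 3-element subsets of $\overline{X}$; here $q$ is assumed even. Construction of $G$: vertices $X=\{x_1,\dots,x_{3q}\}$, $C=\{c_1,\dots,c_t\}$, $A=\{a_1,\dots,a_{3q}\}$, $B=\{b_1,\dots,b_{3q}\}$, $Y=\{y_1,\dots,y_{10q}\}$, $Z=\{z_1,\dots,z_{10q}\}$. Edges: $x_ic_j$ whenever $\overline{x}_i\in\overline{C}_j$; $x_ia_i$ and $x_ib_i$ for each $i\in[3q]$; all edges among $A\cup B\cup C$ (so $A\cup B\cup C$ is a clique); $A$ is partitioned arbitrarily into $q/2$ pairwise disjoint 6-element sets $A^1,\dots,A^{q/2}$ and $Z$ into $q/2$ pairwise disjoint 20-element sets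 $Z^1,\dots,Z^{q/2}$, and for each $\ell$ the 20 vertices of $Z^\ell$ are put in bijection with the 20 three-element subsets of $A^\ell$, each vertex of $Z^\ell$ being made adjacent exactly to the three vertices of its triple; the same is done between $B$ and $Y$ (partition $B$ into 6-sets, $Y$ into 20-sets, pair them, each vertex of a 20-set adjacent to a distinct triple of its paired 6-set). There are no other edges. ($G$ is a split graph with clique $A\cup B\cup C$ and independent set $X\cup Y\cup Z$.) -}

module Defs where

open import Data.Nat using (ℕ; zero; suc; _+_; _*_; _≤_)
open import Data.Fin using (Fin; zero; suc)
open import Data.Fin.Properties using () renaming (_≟_ to _≟F_)
open import Data.Fin.Subset using (Subset; ∣_∣)
open import Data.Vec using (lookup)
open import Data.Bool using (Bool; true; false; if_then_else_; not; _∧_)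
open import Data.Product using (Σ; _×_; _,_; proj₁; proj₂)
open import Relation.Nullary.Decidable using (⌊_⌋)
open import Relation.Binary.PropositionalEquality using (_≡_)
open import Function.Bundles using (_↔_; Inverse)

sumFin : (n : ℕ) → (Fin n → ℕ) → ℕ
sumFin zero    g = 0
sumFin (suc n) g = g zero + sumFin n (λ i → g (suc i))

Triple6 : Set
Triple6 = Σ (Subset 6) (λ s → ∣ s ∣ ≡ 3)

-- An Exact 3-Cover instance with |X̄| = 3q, q = 2k, together with the
-- (arbitrary) choices made in the construction of G.
record Instance (k : ℕ) : Set where
  field
    t   : ℕ
    C̄   : Fin t → Subset (3 * (2 * k))
    C̄-3 : ∀ j → ∣ C̄ j ∣ ≡ 3
    -- partition of A (resp. B) into q/2 = k blocks of size 6: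
    -- a_i lies in block ℓ at position r iff σA i = (ℓ , r)
    σA  : Fin (3 * (2 * k)) ↔ (Fin k × Fin 6)
    σB  : Fin (3 * (2 * k)) ↔ (Fin k × Fin 6)
    -- partition of Z (resp. Y) into k blocks of size 20, with each block
    -- Z^ℓ in bijection with the 3-subsets of A^ℓ:
    -- z_i lies in Z^ℓ and corresponds to the triple T iff σZ i = (ℓ , T)
    σZ  : Fin (10 * (2 * k)) ↔ (Fin k × Triple6)
    σY  : Fin (10 * (2 * k)) ↔ (Fin k × Triple6)

module Graph {k : ℕ} (I : Instance k) where
  open Instance I

  q : ℕ
  q = 2 * k

  data V : Set where
    x : Fin (3 * q) → V
    c : Fin t → V
    a : Fin (3 * q) → V
    b : Fin (3 * q) → V
    y : Fin (10 * q) → V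
    z : Fin (10 * q) → V

  eqF : ∀ {n} → Fin n → Fin n → Bool
  eqF i j = ⌊ i ≟F j ⌋

  tripleAdj : Fin k × Triple6 → Fin k × Fin 6 → Bool
  tripleAdj (ℓ , T) (ℓ' , r) = eqF ℓ ℓ' ∧ lookup (proj₁ T) r

  adj : V → V → Bool
  adj (x i) (c j) = lookup (C̄ j) i
  adj (c j) (x i) = lookup (C̄ j) i
  adj (x i) (a i') = eqF i i'
  adj (a i') (x i) = eqF i i'
  adj (x i) (b i') = eqF i i'
  adj (b i') (x i) = eqF i i'
  adj (a i) (a i') = not (eqF i i')
  adj (b i) (b i') = not (eqF i i')
  adj (c j) (c j') = not (eqF j j')
  adj (a _) (b _) = true
  adj (b _) (a _) = true
  adj (a _) (c _) = true
  adj (c _) (a _) = true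
  adj (b _) (c _) = true
  adj (c _) (b _) = true
  adj (z i) (a i') = tripleAdj (Inverse.to σZ i) (Inverse.to σA i')
  adj (a i') (z i) = tripleAdj (Inverse.to σZ i) (Inverse.to σA i')
  adj (y i) (b i') = tripleAdj (Inverse.to σY i) (Inverse.to σB i')
  adj (b i') (y i) = tripleAdj (Inverse.to σY i) (Inverse.to σB i')
  adj _ _ = false

  total : (V → ℕ) → ℕ
  total g = sumFin (3 * q) (λ i → g (x i)) + sumFin t (λ j → g (c j))
          + sumFin (3 * q) (λ i → g (a i)) + sumFin (3 * q) (λ i → g (b i))
          + sumFin (10 * q) (λ i → g (y i)) + sumFin (10 * q) (λ i → g (z i))

  weight : (V → ℕ) → ℕ
  weight f = total f

  nbSum : (V → ℕ) → V → ℕ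
  nbSum f u = total (λ v → if adj u v then f v else 0)

  fA fB : (V → ℕ) → ℕ
  fA f = sumFin (3 * q) (λ i → f (a i))
  fB f = sumFin (3 * q) (λ i → f (b i))

  record IsR3DF (f : V → ℕ) : Set where
    field
      range : ∀ u → f u ≤ 3
      cond0 : ∀ u → f u ≡ 0 → 3 ≤ nbSum f u
      cond1 : ∀ u → f u ≡ 1 → 2 ≤ nbSum f u

  record IsMinR3DF (f : V → ℕ) : Set where
    field
      isR3DF  : IsR3DF f
      minimal : ∀ g → IsR3DF g → weight f ≤ weight g

-- A vertex of Z sees exactly three vertices of A, and its own value is forced
-- by their total: it is at least 2, 2, 1, 0 when that total is 0, 1, 2, ≥ 3 (forcedWeight).  Summing over
-- the twenty vertices of a block Z^ℓ, a check of all 4^6 value patterns on A^ℓ gives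
-- 6 + #zeros(A^ℓ) ≤ f(A^ℓ) + f(Z^ℓ), hence 3q + #zeros(A) ≤ f(A) + f(Z).  Conversely, raising f to 1 on the
-- zeros of A and lowering it to 0 on Z keeps it an R{3}DF (each z now sees three positive vertices, each a
-- sees the other 3q - 1 ≥ 2 positive A-vertices), so minimality gives f(Z) ≤ #zeros(A), and f(A) ≥ 3q
-- follows.  The bound for B is the same statement for the instance with (A, Z) and (B, Y) exchanged.

module Submission where

open import Defs
open import Data.Nat using (ℕ; zero; suc; _+_; _*_; _∸_; _⊔_; _≤_; _<_; _≤?_; _≟_; z≤n; s≤s)
open import Data.Nat.Properties
  using ( +-0-commutativeMonoid; +-identityʳ; +-assoc; +-mono-≤; +-monoˡ-≤; +-monoʳ-≤
        ; +-cancelˡ-≤; +-cancelʳ-≤; *-zeroʳ; *-identityʳ; *-assoc; *-comm; *-monoʳ-≤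
        ; ≤-refl; ≤-reflexive; ≤-trans; ≤-pred; m≤m+n; m≤n+m; 0∸n≡0
        ; ⊔-identityʳ; ⊔-lub; m≤m⊔n; m≤n⊔m; ≡-irrelevant; allUpTo?; module ≤-Reasoning )
open import Data.Nat.Tactic.RingSolver using (solve-∀)
open import Data.Fin using (Fin; zero; suc; _↑ˡ_; _↑ʳ_; combine)
open import Data.Fin.Patterns using (0F; 1F; 2F; 3F; 4F; 5F)
open import Data.Fin.Properties using (all?; any?; suc-injective; remQuot-combine; *↔×) renaming (_≟_ to _≟ᶠ_)
open import Data.Fin.Subset using (Subset; ∣_∣)
open import Data.Fin.Subset.Properties using (anySubset?)
open import Data.Vec using (Vec; []; _∷_; lookup)
open import Data.Vec.Properties using (≡-dec)
open import Data.Bool using (true; false; if_then_else_; not; _∧_)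
open import Data.Bool.Properties using () renaming (_≟_ to _≟ᵇ_)
open import Data.Product using (_×_; _,_; proj₁; proj₂; ∃)
open import Data.Product.Properties using (Σ-≡,≡→≡)
open import Data.Product.Function.NonDependent.Propositional using (_×-↔_)
open import Function using (_∘_)
open import Function.Bundles using (_↔_; Inverse; mk↔ₛ′)
open import Function.Construct.Composition using (_↔-∘_)
open import Function.Construct.Identity using (↔-id)
open import Function.Construct.Symmetry using (↔-sym)
open import Relation.Binary.PropositionalEquality
open import Relation.Nullary using (Dec; yes; no; ¬?; contradiction)
open import Relation.Nullary.Decidable using (⌊_⌋; from-yes; decidable-stable; _→-dec_; isYes≗does; dec-true; dec-false)
open import Relation.Unary using (Pred; Decidable)
import Algebra.Properties.CommutativeMonoid.Sum as MonoidSum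

module ℕSum = MonoidSum +-0-commutativeMonoid

sumFin-cong : ∀ n {g h : Fin n → ℕ} → (∀ i → g i ≡ h i) → sumFin n g ≡ sumFin n h
sumFin-cong zero    g≗h = refl
sumFin-cong (suc n) g≗h = cong₂ _+_ (g≗h zero) (sumFin-cong n (g≗h ∘ suc))

sumFin-mono : ∀ n {g h : Fin n → ℕ} → (∀ i → g i ≤ h i) → sumFin n g ≤ sumFin n h
sumFin-mono zero    g≤h = z≤n
sumFin-mono (suc n) g≤h = +-mono-≤ (g≤h zero) (sumFin-mono n (g≤h ∘ suc))

sumFin-const : ∀ n c → sumFin n (λ _ → c) ≡ n * c
sumFin-const zero    c = refl
sumFin-const (suc n) c = cong (c +_) (sumFin-const n c)

sumFin-zero : ∀ n → sumFin n (λ _ → 0) ≡ 0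
sumFin-zero n = trans (sumFin-const n 0) (*-zeroʳ n)

sumFin≡sum : ∀ n (g : Fin n → ℕ) → sumFin n g ≡ ℕSum.sum g
sumFin≡sum zero    g = refl
sumFin≡sum (suc n) g = cong (g zero +_) (sumFin≡sum n (g ∘ suc))

sumFin-+ : ∀ n (g h : Fin n → ℕ) → sumFin n (λ i → g i + h i) ≡ sumFin n g + sumFin n h
sumFin-+ n g h = begin
  sumFin n (λ i → g i + h i)   ≡⟨ sumFin≡sum n _ ⟩
  ℕSum.sum (λ i → g i + h i)   ≡⟨ ℕSum.∑-distrib-+ g h ⟩
  ℕSum.sum g + ℕSum.sum h      ≡⟨ sym (cong₂ _+_ (sumFin≡sum n g) (sumFin≡sum n h)) ⟩
  sumFin n g + sumFin n h      ∎
  where open ≡-Reasoning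

sumFin-permute : ∀ {m n} (π : Fin m ↔ Fin n) (g : Fin n → ℕ) →
                 sumFin n g ≡ sumFin m (g ∘ Inverse.to π)
sumFin-permute {m} {n} π g = begin
  sumFin n g                      ≡⟨ sumFin≡sum n g ⟩
  ℕSum.sum g                      ≡⟨ ℕSum.sum-permute g π ⟩
  ℕSum.sum (g ∘ Inverse.to π)     ≡⟨ sym (sumFin≡sum m _) ⟩
  sumFin m (g ∘ Inverse.to π)     ∎
  where open ≡-Reasoning

sumFin-++ : ∀ m n (g : Fin (m + n) → ℕ) →
            sumFin (m + n) g ≡ sumFin m (λ i → g (i ↑ˡ n)) + sumFin n (λ j → g (m ↑ʳ j))
sumFin-++ zero    n g = refl
sumFin-++ (suc m) n g = trans (cong (g zero +_) (sumFin-++ m n (g ∘ suc))) (sym (+-assoc (g zero) _ _))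

sumFin-combine : ∀ k m (g : Fin (k * m) → ℕ) →
                 sumFin (k * m) g ≡ sumFin k (λ ℓ → sumFin m (λ r → g (combine ℓ r)))
sumFin-combine zero    m g = refl
sumFin-combine (suc k) m g =
  trans (sumFin-++ m (k * m) g) (cong (sumFin m (λ r → g (r ↑ˡ k * m)) +_) (sumFin-combine k m (λ j → g (m ↑ʳ j))))

sumFin-product : ∀ {N k m} (e : Fin N ↔ (Fin k × Fin m)) (g : Fin N → ℕ) →
                 sumFin N g ≡ sumFin k (λ ℓ → sumFin m (λ r → g (Inverse.from e (ℓ , r))))
sumFin-product {N} {k} {m} e g = begin
  sumFin N g                                                    ≡⟨ sumFin-permute π g ⟩
  sumFin (k * m) (g ∘ Inverse.to π)                             ≡⟨ sumFin-combine k m _ ⟩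
  sumFin k (λ ℓ → sumFin m (λ r → g (Inverse.to π (combine ℓ r))))
    ≡⟨ sumFin-cong k (λ ℓ → sumFin-cong m (λ r → cong (g ∘ Inverse.from e) (remQuot-combine ℓ r))) ⟩
  sumFin k (λ ℓ → sumFin m (λ r → g (Inverse.from e (ℓ , r))))  ∎
  where
  open ≡-Reasoning
  π : Fin (k * m) ↔ Fin N
  π = ↔-sym e ↔-∘ *↔×

sumFin-single : ∀ n (ℓ : Fin n) (g : Fin n → ℕ) → (∀ ℓ′ → ℓ′ ≢ ℓ → g ℓ′ ≡ 0) → sumFin n g ≡ g ℓ
sumFin-single (suc n) zero    g g≡0 =
  trans (cong (g zero +_) (trans (sumFin-cong n (λ i → g≡0 (suc i) λ ())) (sumFin-zero n))) (+-identityʳ _)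
sumFin-single (suc n) (suc ℓ) g g≡0 =
  trans (cong (_+ sumFin n (g ∘ suc)) (g≡0 zero λ ())) (sumFin-single n ℓ (g ∘ suc) λ ℓ′ ℓ′≢ℓ → g≡0 (suc ℓ′) (ℓ′≢ℓ ∘ suc-injective))

n≤sumFin : ∀ n (g : Fin n → ℕ) → (∀ j → 1 ≤ g j) → n ≤ sumFin n g
n≤sumFin n g 1≤g = ≤-trans (≤-reflexive (sym (trans (sumFin-const n 1) (*-identityʳ n)))) (sumFin-mono n 1≤g)

n≤1+sumFin : ∀ n (i : Fin n) (g : Fin n → ℕ) → (∀ j → j ≢ i → 1 ≤ g j) → n ≤ suc (sumFin n g)
n≤1+sumFin (suc n) zero    g 1≤g = s≤s (≤-trans (n≤sumFin n (g ∘ suc) λ j → 1≤g (suc j) λ ()) (m≤n+m _ (g zero)))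
n≤1+sumFin (suc n) (suc i) g 1≤g =
  s≤s (≤-trans (n≤1+sumFin n i (g ∘ suc) λ j j≢i → 1≤g (suc j) (j≢i ∘ suc-injective)) (+-monoˡ-≤ _ (1≤g zero λ ())))

n⊔1≡n+[1∸n] : ∀ n → n ⊔ 1 ≡ n + (1 ∸ n)
n⊔1≡n+[1∸n] zero    = refl
n⊔1≡n+[1∸n] (suc n) = cong suc (trans (⊔-identityʳ n) (sym (trans (cong (n +_) (0∸n≡0 n)) (+-identityʳ n))))

⌊i≟i⌋≡true : ∀ {n} (i : Fin n) → ⌊ i ≟ᶠ i ⌋ ≡ true
⌊i≟i⌋≡true i = trans (isYes≗does (i ≟ᶠ i)) (dec-true (i ≟ᶠ i) refl)

⌊i≟j⌋≡false : ∀ {n} {i j : Fin n} → i ≢ j → ⌊ i ≟ᶠ j ⌋ ≡ false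
⌊i≟j⌋≡false {i = i} {j} i≢j = trans (isYes≗does (i ≟ᶠ j)) (dec-false (i ≟ᶠ j) i≢j)

allSubsets? : ∀ {n p} {P : Pred (Subset n) p} → Decidable P → Dec (∀ s → P s)
allSubsets? P? with anySubset? (¬? ∘ P?)
... | yes (s , ¬Ps) = no λ ∀P → ¬Ps (∀P s)
... | no ∄¬P        = yes λ s → decidable-stable (P? s) λ ¬Ps → ∄¬P (s , ¬Ps)

triples : Vec Triple6 20
triples =
  ((true ∷ true ∷ true ∷ false ∷ false ∷ false ∷ []) , refl)
  ∷ ((true ∷ true ∷ false ∷ true ∷ false ∷ false ∷ []) , refl)
  ∷ ((true ∷ true ∷ false ∷ false ∷ true ∷ false ∷ []) , refl)
  ∷ ((true ∷ true ∷ false ∷ false ∷ false ∷ true ∷ []) , refl)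
  ∷ ((true ∷ false ∷ true ∷ true ∷ false ∷ false ∷ []) , refl)
  ∷ ((true ∷ false ∷ true ∷ false ∷ true ∷ false ∷ []) , refl)
  ∷ ((true ∷ false ∷ true ∷ false ∷ false ∷ true ∷ []) , refl)
  ∷ ((true ∷ false ∷ false ∷ true ∷ true ∷ false ∷ []) , refl)
  ∷ ((true ∷ false ∷ false ∷ true ∷ false ∷ true ∷ []) , refl)
  ∷ ((true ∷ false ∷ false ∷ false ∷ true ∷ true ∷ []) , refl)
  ∷ ((false ∷ true ∷ true ∷ true ∷ false ∷ false ∷ []) , refl)
  ∷ ((false ∷ true ∷ true ∷ false ∷ true ∷ false ∷ []) , refl)
  ∷ ((false ∷ true ∷ true ∷ false ∷ false ∷ true ∷ []) , refl)
  ∷ ((false ∷ true ∷ false ∷ true ∷ true ∷ false ∷ []) , refl)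
  ∷ ((false ∷ true ∷ false ∷ true ∷ false ∷ true ∷ []) , refl)
  ∷ ((false ∷ true ∷ false ∷ false ∷ true ∷ true ∷ []) , refl)
  ∷ ((false ∷ false ∷ true ∷ true ∷ true ∷ false ∷ []) , refl)
  ∷ ((false ∷ false ∷ true ∷ true ∷ false ∷ true ∷ []) , refl)
  ∷ ((false ∷ false ∷ true ∷ false ∷ true ∷ true ∷ []) , refl)
  ∷ ((false ∷ false ∷ false ∷ true ∷ true ∷ true ∷ []) , refl)
  ∷ []

triple : Fin 20 → Triple6
triple = lookup triples

triple-injective : ∀ i j → proj₁ (triple i) ≡ proj₁ (triple j) → i ≡ j
triple-injective = from-yes (all? λ i → all? λ j → ≡-dec _≟ᵇ_ (proj₁ (triple i)) (proj₁ (triple j)) →-dec (i ≟ᶠ j))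

triple-surjective : ∀ s → ∣ s ∣ ≡ 3 → ∃ λ j → proj₁ (triple j) ≡ s
triple-surjective = from-yes (allSubsets? λ s → (∣ s ∣ ≟ 3) →-dec any? λ j → ≡-dec _≟ᵇ_ (proj₁ (triple j)) s)

triple↔ : Fin 20 ↔ Triple6
triple↔ = mk↔ₛ′ triple index triple-index index-triple
  where
  index : Triple6 → Fin 20
  index (s , ∣s∣≡3) = proj₁ (triple-surjective s ∣s∣≡3)
  triple-index : ∀ T → triple (index T) ≡ T
  triple-index (s , ∣s∣≡3) = Σ-≡,≡→≡ (proj₂ (triple-surjective s ∣s∣≡3) , ≡-irrelevant _ _)
  index-triple : ∀ j → index (triple j) ≡ j
  index-triple j = triple-injective _ _ (cong proj₁ (triple-index (triple j)))

subsetSum : ∀ {n} → (Fin n → ℕ) → Subset n → ℕ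
subsetSum {n} v s = sumFin n (λ r → if lookup s r then v r else 0)

∣s∣≤subsetSum : ∀ {n} (v : Fin n → ℕ) (s : Subset n) → (∀ r → 1 ≤ v r) → ∣ s ∣ ≤ subsetSum v s
∣s∣≤subsetSum v []          1≤v = z≤n
∣s∣≤subsetSum v (true ∷ s)  1≤v = +-mono-≤ (1≤v zero) (∣s∣≤subsetSum (v ∘ suc) s (1≤v ∘ suc))
∣s∣≤subsetSum v (false ∷ s) 1≤v = ∣s∣≤subsetSum (v ∘ suc) s (1≤v ∘ suc)

forcedWeight : ℕ → ℕ
forcedWeight 0 = 2
forcedWeight 1 = 2
forcedWeight 2 = 1
forcedWeight _ = 0

forcedWeight-≥3 : ∀ {n} → 3 ≤ n → forcedWeight n ≡ 0
forcedWeight-≥3 (s≤s (s≤s (s≤s _))) = refl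

forcedWeight-≥2 : ∀ {n} → 2 ≤ n → forcedWeight n ≤ 1
forcedWeight-≥2 {1}                 (s≤s ())
forcedWeight-≥2 {2}                 _ = ≤-refl
forcedWeight-≥2 {suc (suc (suc _))} _ = z≤n

forcedWeight≤2 : ∀ n → forcedWeight n ≤ 2
forcedWeight≤2 0                   = ≤-refl
forcedWeight≤2 1                   = ≤-refl
forcedWeight≤2 2                   = s≤s z≤n
forcedWeight≤2 (suc (suc (suc _))) = z≤n

BlockBound : (Fin 6 → ℕ) → Set
BlockBound v = 6 + sumFin 6 (λ r → 1 ∸ v r)
             ≤ sumFin 6 v + sumFin 20 (λ j → forcedWeight (subsetSum v (proj₁ (triple j))))

blockBound? : ∀ v → Dec (BlockBound v)
blockBound? v = _ ≤? _

-- Decided for the pattern lookup (v₀ ∷ … ∷ v₅ ∷ []), which is BlockBound v up to conversion.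
blockBound : (v : Fin 6 → ℕ) → (∀ r → v r < 4) → BlockBound v
blockBound v v<4 = from-yes
  (allUpTo? (λ v₀ → allUpTo? (λ v₁ → allUpTo? (λ v₂ → allUpTo? (λ v₃ → allUpTo? (λ v₄ → allUpTo? (λ v₅ →
     blockBound? (lookup (v₀ ∷ v₁ ∷ v₂ ∷ v₃ ∷ v₄ ∷ v₅ ∷ []))) 4) 4) 4) 4) 4) 4)
  (v<4 0F) (v<4 1F) (v<4 2F) (v<4 3F) (v<4 4F) (v<4 5F)

only-third : ∀ {a b c d e f} → a ≡ 0 → b ≡ 0 → d ≡ 0 → e ≡ 0 → f ≡ 0 → a + b + c + d + e + f ≡ c
only-third {c = c} refl refl refl refl refl = trans (+-identityʳ _) (trans (+-identityʳ _) (+-identityʳ c))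

module _ {k : ℕ} (I : Instance k) where
  open Instance I
  open Graph I
  open Inverse

  total-cong : ∀ {F G : V → ℕ} → (∀ v → F v ≡ G v) → total F ≡ total G
  total-cong F≗G = cong₂ _+_ (cong₂ _+_ (cong₂ _+_ (cong₂ _+_ (cong₂ _+_
    (sumFin-cong _ (F≗G ∘ x)) (sumFin-cong _ (F≗G ∘ c))) (sumFin-cong _ (F≗G ∘ a)))
    (sumFin-cong _ (F≗G ∘ b))) (sumFin-cong _ (F≗G ∘ y))) (sumFin-cong _ (F≗G ∘ z))

  total-mono : ∀ {F G : V → ℕ} → (∀ v → F v ≤ G v) → total F ≤ total G
  total-mono F≤G = +-mono-≤ (+-mono-≤ (+-mono-≤ (+-mono-≤ (+-mono-≤
    (sumFin-mono _ (F≤G ∘ x)) (sumFin-mono _ (F≤G ∘ c))) (sumFin-mono _ (F≤G ∘ a)))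
    (sumFin-mono _ (F≤G ∘ b))) (sumFin-mono _ (F≤G ∘ y))) (sumFin-mono _ (F≤G ∘ z))

  sumA≤total : ∀ (F : V → ℕ) → sumFin (3 * q) (F ∘ a) ≤ total F
  sumA≤total F = ≤-trans (m≤n+m _ (sumFin _ (F ∘ x) + sumFin t (F ∘ c)))
    (≤-trans (m≤m+n _ _) (≤-trans (m≤m+n _ _) (m≤m+n _ _)))

  blockValues : (V → ℕ) → Fin k → Fin 6 → ℕ
  blockValues h ℓ r = h (a (from σA (ℓ , r)))

  -- 1 ∸ n is the indicator of n ≡ 0.
  fZ zerosA : (V → ℕ) → ℕ
  fZ f     = sumFin (10 * q) (f ∘ z)
  zerosA f = sumFin (3 * q) (λ i → 1 ∸ f (a i))

  sumA-blocks : ∀ (w : Fin (3 * q) → ℕ) → sumFin (3 * q) w ≡ sumFin k (λ ℓ → sumFin 6 (λ r → w (from σA (ℓ , r))))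
  sumA-blocks = sumFin-product σA

  nbSum-z : ∀ (h : V → ℕ) i → let (ℓ , T) = to σZ i in nbSum h (z i) ≡ subsetSum (blockValues h ℓ) (proj₁ T)
  nbSum-z h i = trans (only-third (sumFin-zero (3 * q)) (sumFin-zero t) (sumFin-zero (3 * q))
                                  (sumFin-zero (10 * q)) (sumFin-zero (10 * q)))
    (begin
      sumFin (3 * q) (λ i′ → if tripleAdj (ℓ , T) (to σA i′) then h (a i′) else 0)
        ≡⟨ sumA-blocks _ ⟩
      sumFin k (λ ℓ′ → sumFin 6 (λ r → if tripleAdj (ℓ , T) (to σA (from σA (ℓ′ , r))) then blockValues h ℓ′ r else 0))
        ≡⟨ sumFin-cong k (λ ℓ′ → sumFin-cong 6 (λ r → cong (λ p → if tripleAdj (ℓ , T) p then blockValues h ℓ′ r else 0)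
                                                         (strictlyInverseˡ σA (ℓ′ , r)))) ⟩
      sumFin k row
        ≡⟨ sumFin-single k ℓ row other-rows-vanish ⟩
      row ℓ
        ≡⟨ cong (λ β → sumFin 6 (λ r → if β ∧ lookup (proj₁ T) r then blockValues h ℓ r else 0)) (⌊i≟i⌋≡true ℓ) ⟩
      subsetSum (blockValues h ℓ) (proj₁ T)  ∎)
    where
    open ≡-Reasoning
    ℓ = proj₁ (to σZ i)
    T = proj₂ (to σZ i)
    row : Fin k → ℕ
    row ℓ′ = sumFin 6 (λ r → if eqF ℓ ℓ′ ∧ lookup (proj₁ T) r then blockValues h ℓ′ r else 0)
    other-rows-vanish : ∀ ℓ′ → ℓ′ ≢ ℓ → row ℓ′ ≡ 0
    other-rows-vanish ℓ′ ℓ′≢ℓ = trans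
      (cong (λ β → sumFin 6 (λ r → if β ∧ lookup (proj₁ T) r then blockValues h ℓ′ r else 0)) (⌊i≟j⌋≡false (ℓ′≢ℓ ∘ sym)))
      (sumFin-zero 6)

  forcedWeight≤ : ∀ {f} → IsR3DF f → ∀ u → forcedWeight (nbSum f u) ≤ f u
  forcedWeight≤ {f} R u with f u in fu≡
  ... | 0           = ≤-reflexive (forcedWeight-≥3 (IsR3DF.cond0 R u fu≡))
  ... | 1           = forcedWeight-≥2 (IsR3DF.cond1 R u fu≡)
  ... | suc (suc _) = ≤-trans (forcedWeight≤2 (nbSum f u)) (s≤s (s≤s z≤n))

  forcedWeights≤fZ : ∀ {f} → IsR3DF f →
    sumFin k (λ ℓ → sumFin 20 (λ j → forcedWeight (subsetSum (blockValues f ℓ) (proj₁ (triple j))))) ≤ fZ f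
  forcedWeights≤fZ {f} R = begin
    sumFin k (λ ℓ → sumFin 20 (λ j → forcedAt (ℓ , triple j)))
      ≡⟨ sumFin-cong k (λ ℓ → sumFin-cong 20 (λ j → cong forcedAt (sym (strictlyInverseˡ σZ (ℓ , triple j))))) ⟩
    sumFin k (λ ℓ → sumFin 20 (λ j → forcedAt (to σZ (from e (ℓ , j)))))
      ≡⟨ sym (sumFin-product e (forcedAt ∘ to σZ)) ⟩
    sumFin (10 * q) (forcedAt ∘ to σZ)
      ≡⟨ sumFin-cong (10 * q) (λ i → cong forcedWeight (sym (nbSum-z f i))) ⟩
    sumFin (10 * q) (λ i → forcedWeight (nbSum f (z i)))
      ≤⟨ sumFin-mono (10 * q) (forcedWeight≤ R ∘ z) ⟩
    fZ f ∎
    where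
    open ≤-Reasoning
    -- from e (ℓ , j) reduces to from σZ (ℓ , triple j).
    e : Fin (10 * q) ↔ (Fin k × Fin 20)
    e = (↔-id (Fin k) ×-↔ ↔-sym triple↔) ↔-∘ σZ
    forcedAt : Fin k × Triple6 → ℕ
    forcedAt (ℓ , T) = forcedWeight (subsetSum (blockValues f ℓ) (proj₁ T))

  3q+zerosA≤fA+fZ : ∀ {f} → IsR3DF f → 3 * q + zerosA f ≤ fA f + fZ f
  3q+zerosA≤fA+fZ {f} R = begin
    3 * q + zerosA f
      ≡⟨ cong₂ _+_ 3q≡Σ6 (sumA-blocks _) ⟩
    sumFin k (λ _ → 6) + sumFin k (λ ℓ → sumFin 6 (λ r → 1 ∸ blockValues f ℓ r))
      ≡⟨ sym (sumFin-+ k _ _) ⟩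
    sumFin k (λ ℓ → 6 + sumFin 6 (λ r → 1 ∸ blockValues f ℓ r))
      ≤⟨ sumFin-mono k (λ ℓ → blockBound (blockValues f ℓ) (λ r → s≤s (IsR3DF.range R _))) ⟩
    sumFin k (λ ℓ → sumFin 6 (blockValues f ℓ) + forced ℓ)
      ≡⟨ sumFin-+ k _ _ ⟩
    sumFin k (λ ℓ → sumFin 6 (blockValues f ℓ)) + sumFin k forced
      ≡⟨ cong (_+ sumFin k forced) (sym (sumA-blocks (f ∘ a))) ⟩
    fA f + sumFin k forced
      ≤⟨ +-monoʳ-≤ (fA f) (forcedWeights≤fZ R) ⟩
    fA f + fZ f ∎
    where
    open ≤-Reasoning
    3q≡Σ6 : 3 * q ≡ sumFin k (λ _ → 6)
    3q≡Σ6 = trans (sym (*-assoc 3 2 k)) (trans (*-comm 6 k) (sym (sumFin-const k 6)))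
    forced : Fin k → ℕ
    forced ℓ = sumFin 20 (λ j → forcedWeight (subsetSum (blockValues f ℓ) (proj₁ (triple j))))

  raise : (V → ℕ) → V → ℕ
  raise f (a i) = f (a i) ⊔ 1
  raise f (z i) = 0
  raise f u     = f u

  nbSum≤nbSum-raise : ∀ f u → (∀ j → adj u (z j) ≡ false) → nbSum f u ≤ nbSum (raise f) u
  nbSum≤nbSum-raise f u u≁Z = total-mono pointwise
    where
    pointwise : ∀ v → (if adj u v then f v else 0) ≤ (if adj u v then raise f v else 0)
    pointwise (x j) = ≤-refl
    pointwise (c j) = ≤-refl
    pointwise (b j) = ≤-refl
    pointwise (y j) = ≤-refl
    pointwise (a j) with adj u (a j)
    ... | true  = m≤m⊔n (f (a j)) 1
    ... | false = z≤n
    pointwise (z j) rewrite u≁Z j = z≤n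

  3≤nbSum-raise-z : ∀ f i → 3 ≤ nbSum (raise f) (z i)
  3≤nbSum-raise-z f i = begin
    3                                              ≡⟨ sym (proj₂ T) ⟩
    ∣ proj₁ T ∣                                    ≤⟨ ∣s∣≤subsetSum (blockValues (raise f) ℓ) (proj₁ T) (λ r → m≤n⊔m _ 1) ⟩
    subsetSum (blockValues (raise f) ℓ) (proj₁ T)  ≡⟨ sym (nbSum-z (raise f) i) ⟩
    nbSum (raise f) (z i)                          ∎
    where
    open ≤-Reasoning
    ℓ = proj₁ (to σZ i)
    T = proj₂ (to σZ i)

  2≤nbSum-raise-a : 1 ≤ k → ∀ f i → 2 ≤ nbSum (raise f) (a i)
  2≤nbSum-raise-a k≥1 f i = ≤-trans (≤-pred (≤-trans 3≤3q (n≤1+sumFin (3 * q) i _ other-a-raised)))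
                                    (sumA≤total (λ v → if adj (a i) v then raise f v else 0))
    where
    3≤3q : 3 ≤ 3 * q
    3≤3q = *-monoʳ-≤ 3 (≤-trans k≥1 (m≤m+n k _))
    other-a-raised : ∀ j → j ≢ i → 1 ≤ (if not (eqF i j) then f (a j) ⊔ 1 else 0)
    other-a-raised j j≢i rewrite ⌊i≟j⌋≡false (j≢i ∘ sym) = m≤n⊔m _ 1

  raise-isR3DF : 1 ≤ k → ∀ {f} → IsR3DF f → IsR3DF (raise f)
  raise-isR3DF k≥1 {f} R = record { range = range′ ; cond0 = cond0′ ; cond1 = cond1′ }
    where
    open IsR3DF R
    range′ : ∀ u → raise f u ≤ 3
    range′ (x i) = range (x i)
    range′ (c i) = range (c i)
    range′ (a i) = ⊔-lub (range (a i)) (s≤s z≤n)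
    range′ (b i) = range (b i)
    range′ (y i) = range (y i)
    range′ (z i) = z≤n
    cond0′ : ∀ u → raise f u ≡ 0 → 3 ≤ nbSum (raise f) u
    cond0′ (x i) e = ≤-trans (cond0 (x i) e) (nbSum≤nbSum-raise f (x i) λ _ → refl)
    cond0′ (c i) e = ≤-trans (cond0 (c i) e) (nbSum≤nbSum-raise f (c i) λ _ → refl)
    cond0′ (a i) e = contradiction (subst (1 ≤_) e (m≤n⊔m _ 1)) λ ()
    cond0′ (b i) e = ≤-trans (cond0 (b i) e) (nbSum≤nbSum-raise f (b i) λ _ → refl)
    cond0′ (y i) e = ≤-trans (cond0 (y i) e) (nbSum≤nbSum-raise f (y i) λ _ → refl)
    cond0′ (z i) e = 3≤nbSum-raise-z f i
    cond1′ : ∀ u → raise f u ≡ 1 → 2 ≤ nbSum (raise f) u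
    cond1′ (x i) e = ≤-trans (cond1 (x i) e) (nbSum≤nbSum-raise f (x i) λ _ → refl)
    cond1′ (c i) e = ≤-trans (cond1 (c i) e) (nbSum≤nbSum-raise f (c i) λ _ → refl)
    cond1′ (a i) e = 2≤nbSum-raise-a k≥1 f i
    cond1′ (b i) e = ≤-trans (cond1 (b i) e) (nbSum≤nbSum-raise f (b i) λ _ → refl)
    cond1′ (y i) e = ≤-trans (cond1 (y i) e) (nbSum≤nbSum-raise f (y i) λ _ → refl)
    cond1′ (z i) ()

  weight-raise : ∀ f → weight (raise f) + fZ f ≡ weight f + zerosA f
  weight-raise f = begin
    weight (raise f) + fZ f
      ≡⟨ cong₂ (λ A′ Z′ → X + C + A′ + B + Y + Z′ + fZ f) raisedA (sumFin-zero (10 * q)) ⟩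
    X + C + (fA f + zerosA f) + B + Y + 0 + fZ f
      ≡⟨ rearrange X C (fA f) (zerosA f) B Y (fZ f) ⟩
    weight f + zerosA f ∎
    where
    open ≡-Reasoning
    X = sumFin (3 * q) (f ∘ x)
    C = sumFin t (f ∘ c)
    B = fB f
    Y = sumFin (10 * q) (f ∘ y)
    raisedA : sumFin (3 * q) (λ i → f (a i) ⊔ 1) ≡ fA f + zerosA f
    raisedA = trans (sumFin-cong (3 * q) (n⊔1≡n+[1∸n] ∘ f ∘ a)) (sumFin-+ (3 * q) _ _)
    rearrange : ∀ X C A A₀ B Y Z → X + C + (A + A₀) + B + Y + 0 + Z ≡ X + C + A + B + Y + Z + A₀
    rearrange = solve-∀

  fZ≤zerosA : 1 ≤ k → ∀ {f} → IsMinR3DF f → fZ f ≤ zerosA f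
  fZ≤zerosA k≥1 {f} M = +-cancelˡ-≤ (weight f) _ _ (begin
    weight f + fZ f          ≤⟨ +-monoˡ-≤ (fZ f) (minimal (raise f) (raise-isR3DF k≥1 isR3DF)) ⟩
    weight (raise f) + fZ f  ≡⟨ weight-raise f ⟩
    weight f + zerosA f      ∎)
    where
    open IsMinR3DF M
    open ≤-Reasoning

  3q≤fA : 1 ≤ k → ∀ {f} → IsMinR3DF f → 3 * q ≤ fA f
  3q≤fA k≥1 {f} M = +-cancelʳ-≤ (zerosA f) _ _ (begin
    3 * q + zerosA f  ≤⟨ 3q+zerosA≤fA+fZ (IsMinR3DF.isR3DF M) ⟩
    fA f + fZ f       ≤⟨ +-monoʳ-≤ (fA f) (fZ≤zerosA k≥1 M) ⟩
    fA f + zerosA f   ∎)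
    where open ≤-Reasoning

swapInstance : ∀ {k} → Instance k → Instance k
swapInstance I = record I { σA = σB ; σB = σA ; σZ = σY ; σY = σZ }
  where open Instance I

module _ {k : ℕ} (I : Instance k) where
  private
    module G  = Graph I
    module G′ = Graph (swapInstance I)
  open Instance I using (t)

  swapVertex : G.V → G′.V
  swapVertex (G.x i) = G′.x i
  swapVertex (G.c i) = G′.c i
  swapVertex (G.a i) = G′.b i
  swapVertex (G.b i) = G′.a i
  swapVertex (G.y i) = G′.z i
  swapVertex (G.z i) = G′.y i

  adj-swap : ∀ u v → G′.adj (swapVertex u) (swapVertex v) ≡ G.adj u v
  adj-swap (G.x i) (G.x j) = refl
  adj-swap (G.x i) (G.c j) = refl
  adj-swap (G.x i) (G.a j) = refl
  adj-swap (G.x i) (G.b j) = refl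
  adj-swap (G.x i) (G.y j) = refl
  adj-swap (G.x i) (G.z j) = refl
  adj-swap (G.c i) (G.x j) = refl
  adj-swap (G.c i) (G.c j) = refl
  adj-swap (G.c i) (G.a j) = refl
  adj-swap (G.c i) (G.b j) = refl
  adj-swap (G.c i) (G.y j) = refl
  adj-swap (G.c i) (G.z j) = refl
  adj-swap (G.a i) (G.x j) = refl
  adj-swap (G.a i) (G.c j) = refl
  adj-swap (G.a i) (G.a j) = refl
  adj-swap (G.a i) (G.b j) = refl
  adj-swap (G.a i) (G.y j) = refl
  adj-swap (G.a i) (G.z j) = refl
  adj-swap (G.b i) (G.x j) = refl
  adj-swap (G.b i) (G.c j) = refl
  adj-swap (G.b i) (G.a j) = refl
  adj-swap (G.b i) (G.b j) = refl
  adj-swap (G.b i) (G.y j) = refl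
  adj-swap (G.b i) (G.z j) = refl
  adj-swap (G.y i) (G.x j) = refl
  adj-swap (G.y i) (G.c j) = refl
  adj-swap (G.y i) (G.a j) = refl
  adj-swap (G.y i) (G.b j) = refl
  adj-swap (G.y i) (G.y j) = refl
  adj-swap (G.y i) (G.z j) = refl
  adj-swap (G.z i) (G.x j) = refl
  adj-swap (G.z i) (G.c j) = refl
  adj-swap (G.z i) (G.a j) = refl
  adj-swap (G.z i) (G.b j) = refl
  adj-swap (G.z i) (G.y j) = refl
  adj-swap (G.z i) (G.z j) = refl

  total-swap : ∀ h → G′.total h ≡ G.total (h ∘ swapVertex)
  total-swap h = swap-middle (sumFin (3 * G.q) (h ∘ G′.x)) (sumFin t (h ∘ G′.c))
    (sumFin (3 * G.q) (h ∘ G′.a)) (sumFin (3 * G.q) (h ∘ G′.b)) (sumFin (10 * G.q) (h ∘ G′.y)) (sumFin (10 * G.q) (h ∘ G′.z))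
    where
    swap-middle : ∀ X C A B Y Z → X + C + A + B + Y + Z ≡ X + C + B + A + Z + Y
    swap-middle = solve-∀

  nbSum-swap : ∀ h u → G′.nbSum h (swapVertex u) ≡ G.nbSum (h ∘ swapVertex) u
  nbSum-swap h u = trans (total-swap (λ v → if G′.adj (swapVertex u) v then h v else 0))
    (total-cong I λ v → cong (λ β → if β then h (swapVertex v) else 0) (adj-swap u v))

  isR3DF-swap : ∀ {h} → G′.IsR3DF h → G.IsR3DF (h ∘ swapVertex)
  isR3DF-swap {h} R = record
    { range = G′.IsR3DF.range R ∘ swapVertex
    ; cond0 = λ u e → subst (3 ≤_) (nbSum-swap h u) (G′.IsR3DF.cond0 R (swapVertex u) e)
    ; cond1 = λ u e → subst (2 ≤_) (nbSum-swap h u) (G′.IsR3DF.cond1 R (swapVertex u) e)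
    }

-- swapInstance is an involution up to record η, so swapVertex (swapInstance I) leads back into Graph I.
isMinR3DF-swap : ∀ {k} (I : Instance k) {f} →
                 Graph.IsMinR3DF I f → Graph.IsMinR3DF (swapInstance I) (f ∘ swapVertex (swapInstance I))
isMinR3DF-swap I {f} M = record
  { isR3DF  = isR3DF-swap (swapInstance I) (IsMinR3DF.isR3DF M)
  ; minimal = λ g R → subst₂ _≤_ (total-swap (swapInstance I) f) (sym (total-swap I g))
                                 (IsMinR3DF.minimal M (g ∘ swapVertex I) (isR3DF-swap I R))
  }
  where open Graph I using (IsMinR3DF)

lemma1 : (k : ℕ) (I : Instance k) (f : Graph.V I → ℕ) → Graph.IsMinR3DF I f → (3 * (2 * k) ≤ Graph.fA I f) × (3 * (2 * k) ≤ Graph.fB I f)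
lemma1 zero    I f M = z≤n , z≤n
lemma1 (suc k) I f M = 3q≤fA I (s≤s z≤n) M , 3q≤fA (swapInstance I) (s≤s z≤n) (isMinR3DF-swap I M)
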